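{- For each $n\in\mathbb{N}$, let $\mathbf{P}^{\mathrm{Dyck}}_n$ be the uniform probability measure on the set of Dyck paths of length $2n$, i.e. integer sequences $(x_0,x_1,\dots,x_{2n})$ with $x_0=0$, $|x_i-x_{i-1}|=1$ for all $i$, $x_{2n}=0$ and $x_1,\dots,x_{2n-1}\ge 0$. Let $\mathfrak{Z}_n = \{0\}\cup\{t\in\{1,\dots,n\} : x_{2t}=0\}$. Then for each $k\in\{2,3,\dots\}$, $$\lim_{n\to\infty}\mathbf{P}^{\mathrm{Dyck}}_n(|\mathfrak{Z}_n| = k) = (k-1)2^{ -k}.$$ -}

module Defs where

open import Data.Bool using (Bool; true; false)
open import Data.Nat as ℕ using (ℕ; zero; suc; _∸_; _^_)
open import Data.Nat.Properties using (m^n≢0)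
open import Data.Integer as ℤ using (ℤ; +_; -[1+_])
open import Data.List using (List; []; _∷_; map; take; length; filter; upTo; applyUpTo; concatMap)
open import Data.List.Relation.Unary.All using (All; all?)
open import Data.Product using (_×_; ∃-syntax)
open import Data.Sum using (_⊎_)
open import Relation.Nullary.Decidable using (_×-dec_; _⊎-dec_)
open import Relation.Binary.PropositionalEquality using (_≡_)
open import Data.Rational as ℚ using (ℚ; 0ℚ; _/_)

-- A path of length m is encoded by its step sequence s ∈ {+1,-1}^m
-- (true = +1, false = -1); the integer sequence is x_i = s_1 + ... + s_i.
step : Bool → ℤ
step true  = + 1
step false = -[1+ 0 ]

sumℤ : List ℤ → ℤ
sumℤ []       = + 0
sumℤ (a ∷ as) = a ℤ.+ sumℤ as

height : List Bool → ℕ → ℤ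
height s i = sumℤ (map step (take i s))

allSeqs : ℕ → List (List Bool)
allSeqs zero    = [] ∷ []
allSeqs (suc m) = concatMap (λ s → (true ∷ s) ∷ (false ∷ s) ∷ []) (allSeqs m)

IsDyck : ℕ → List Bool → Set
IsDyck n s = height s (2 ℕ.* n) ≡ + 0 × All (λ i → + 0 ℤ.≤ height s i) (applyUpTo suc (2 ℕ.* n ∸ 1))

isDyck? : ∀ n s → Relation.Nullary.Decidable.Dec (IsDyck n s)
isDyck? n s = (height s (2 ℕ.* n) ℤ.≟ + 0) ×-dec all? (λ i → + 0 ℤ.≤? height s i) (applyUpTo suc (2 ℕ.* n ∸ 1))

-- the set of Dyck paths of length 2n (each listed exactly once)
dyckPaths : ℕ → List (List Bool)
dyckPaths n = filter (isDyck? n) (allSeqs (2 ℕ.* n))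

zeroSetSize : ℕ → List Bool → ℕ
zeroSetSize n s = length (filter (λ t → (t ℕ.≟ 0) ⊎-dec (height s (2 ℕ.* t) ℤ.≟ + 0)) (upTo (suc n)))

-- uniform probability of an event (given by a decidable predicate) on a finite list
-- (convention: 0 on the empty list; irrelevant here since Dyck paths always exist)
uniformProb : {A : Set} → {P : A → Set} → ((a : A) → Relation.Nullary.Decidable.Dec (P a)) → List A → ℚ
uniformProb P? xs with length xs
... | zero  = 0ℚ
... | suc m = + length (filter P? xs) / suc m

probZeroSetSize : ℕ → ℕ → ℚ
probZeroSetSize n k = uniformProb (λ s → zeroSetSize n s ℕ.≟ k) (dyckPaths n)

limitValue : ℕ → ℚ
limitValue k = (+ (k ∸ 1) / (2 ^ k)) {{m^n≢0 2 k}}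

ConvergesTo : (ℕ → ℚ) → ℚ → Set
ConvergesTo a L = ∀ (ε : ℚ) → 0ℚ ℚ.< ε → ∃[ N ] (∀ n → N ℕ.≤ n → ℚ.∣ a n ℚ.- L ∣ ℚ.< ε)

-- Decomposing a walk by its first step turns the number of Dyck paths of length 2n into the Catalan number
-- ballot (2n) 0, and the number of those with exactly k − 1 returns to 0 into the ballot number
-- ballot (2n − k) (k − 2).  The reflection principle writes ballot numbers as differences of binomial
-- coefficients, and absorption identities then turn the probability into (k − 1) 2^(−k) times a quotient of two
-- products of k − 1 factors each, all within 2k of 2n.  Such a quotient is 1 + O(1/n) with an explicit
-- constant, which yields an explicit threshold for every rational ε.
module Submission where

open import Defs
open import Data.Nat using (ℕ; _≤_)

open import Data.Bool using (Bool; true; false; if_then_else_)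
open import Data.Nat as ℕ using (zero; suc; _+_; _*_; _∸_; _<_; _>_; z≤n; s≤s; _^_; ∣_-_∣)
import Data.Nat.Properties as ℕP
import Algebra.Properties.CommutativeSemigroup ℕP.+-commutativeSemigroup as +-CS
import Algebra.Properties.CommutativeSemigroup ℕP.*-commutativeSemigroup as *-CS
open import Data.Nat.ListAction using (sum; product)
open import Data.Integer as ℤ using (ℤ; +_; -[1+_])
import Data.Integer.Properties as ℤP
open import Data.Rational as ℚ using (ℚ; mkℚ; toℚᵘ)
import Data.Rational.Properties as ℚP
open import Data.Rational.Unnormalised as ℚᵘ using (mkℚᵘ; *<*)
import Data.Rational.Unnormalised.Properties as ℚᵘP
open import Data.Nat.Coprimality using (Coprime)
open import Data.List using (List; []; _∷_; map; length; filter; applyUpTo; concatMap)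
open import Data.List.Properties using (map-cong; map-applyUpTo)
import Data.List.Relation.Unary.All.Properties as All
open import Data.Product using (_×_; _,_; proj₁; proj₂)
open import Data.Sum using (_⊎_; inj₁; inj₂)
open import Data.Empty using (⊥-elim)
open import Function using (_∘_; _⇔_; mk⇔; Equivalence)
import Function.Properties.Equivalence as ⇔
open import Relation.Nullary using (Dec; yes; no; does; ¬_; contradiction; _⊎-dec_)
open import Relation.Binary.PropositionalEquality
open import Data.Nat.Combinatorics using (_C_; nCk+nC[k+1]≡[n+1]C[k+1]; nC1≡n; nCk≡nC[n∸k])
open import Data.Nat.Tactic.RingSolver using (solve-∀)

𝟙[_] : ∀ {P : Set} → Dec P → ℕ
𝟙[ P? ] = if does P? then 1 else 0

𝟙-≡ : ∀ {P : Set} (P? : Dec P) {b} → b ≤ 1 → P ⇔ b ≡ 1 → 𝟙[ P? ] ≡ b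
𝟙-≡ (yes p) _           P⇔b≡1 = sym (Equivalence.to P⇔b≡1 p)
𝟙-≡ (no _)  z≤n         _     = refl
𝟙-≡ (no ¬p) (s≤s z≤n)   P⇔b≡1 = contradiction (Equivalence.from P⇔b≡1 refl) ¬p

module _ {A : Set} {P : A → Set} (P? : ∀ a → Dec (P a)) where

  length-filter≡sum : ∀ xs → length (filter P? xs) ≡ sum (map (𝟙[_] ∘ P?) xs)
  length-filter≡sum []       = refl
  length-filter≡sum (x ∷ xs) with does (P? x)
  ... | true  = cong suc (length-filter≡sum xs)
  ... | false = length-filter≡sum xs

  sum-map-filter : ∀ (f : A → ℕ) xs → sum (map f (filter P? xs)) ≡ sum (map (λ x → 𝟙[ P? x ] * f x) xs)
  sum-map-filter f []       = refl
  sum-map-filter f (x ∷ xs) with does (P? x)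
  ... | true  = cong₂ _+_ (sym (ℕP.*-identityˡ (f x))) (sum-map-filter f xs)
  ... | false = sum-map-filter f xs

sum-map-zero : ∀ {A : Set} (xs : List A) → sum (map (λ _ → 0) xs) ≡ 0
sum-map-zero []       = refl
sum-map-zero (_ ∷ xs) = sum-map-zero xs

applyUpTo-cong : ∀ {A : Set} {f g : ℕ → A} → (∀ i → f i ≡ g i) → ∀ n → applyUpTo f n ≡ applyUpTo g n
applyUpTo-cong f≗g zero    = refl
applyUpTo-cong f≗g (suc n) = cong₂ _∷_ (f≗g 0) (applyUpTo-cong (f≗g ∘ suc) n)

m+o≡n⇒m≤n : ∀ {m n} o → m + o ≡ n → m ≤ n
m+o≡n⇒m≤n {m} o m+o≡n = subst (m ≤_) m+o≡n (ℕP.m≤m+n m o)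

Σseqs : ℕ → (List Bool → ℕ) → ℕ
Σseqs m f = sum (map f (allSeqs m))

Σseqs-suc : ∀ m f → Σseqs (suc m) f ≡ Σseqs m (f ∘ (true ∷_)) + Σseqs m (f ∘ (false ∷_))
Σseqs-suc m f = go (allSeqs m)
  where
  go : ∀ xs → sum (map f (concatMap (λ s → (true ∷ s) ∷ (false ∷ s) ∷ []) xs))
            ≡ sum (map (f ∘ (true ∷_)) xs) + sum (map (f ∘ (false ∷_)) xs)
  go []       = refl
  go (s ∷ xs) = trans (cong (λ z → f (true ∷ s) + (f (false ∷ s) + z)) (go xs))
                      (trans (sym (ℕP.+-assoc (f (true ∷ s)) (f (false ∷ s)) (Σt + Σf)))
                             (+-CS.interchange (f (true ∷ s)) (f (false ∷ s)) Σt Σf))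
    where
    Σt Σf : ℕ
    Σt = sum (map (f ∘ (true ∷_)) xs)
    Σf = sum (map (f ∘ (false ∷_)) xs)

Σseqs-cong : ∀ m {f g : List Bool → ℕ} → (∀ s → length s ≡ m → f s ≡ g s) → Σseqs m f ≡ Σseqs m g
Σseqs-cong zero    f≗g = cong (_+ 0) (f≗g [] refl)
Σseqs-cong (suc m) f≗g = trans (Σseqs-suc m _) (trans
  (cong₂ _+_ (Σseqs-cong m (λ s e → f≗g (true ∷ s) (cong suc e)))
             (Σseqs-cong m (λ s e → f≗g (false ∷ s) (cong suc e))))
  (sym (Σseqs-suc m _)))

-- Walks from height h down to 0

nonnegTo0 : ℕ → List Bool → ℕ
nonnegTo0 h       []          = 𝟙[ h ℕ.≟ 0 ]
nonnegTo0 h       (true ∷ s)  = nonnegTo0 (suc h) s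
nonnegTo0 zero    (false ∷ s) = 0
nonnegTo0 (suc h) (false ∷ s) = nonnegTo0 h s

returns : ℕ → List Bool → ℕ
returns h       []          = 0
returns h       (true ∷ s)  = returns (suc h) s
returns zero    (false ∷ s) = 0
returns (suc h) (false ∷ s) = 𝟙[ h ℕ.≟ 0 ] + returns h s

withReturns : ℕ → ℕ → List Bool → ℕ
withReturns h r s = nonnegTo0 h s * 𝟙[ returns h s ℕ.≟ r ]

NonnegTo0 : ℕ → List Bool → Set
NonnegTo0 h s = (+ h ℤ.+ height s (length s) ≡ + 0) × (∀ i → i < length s → + 0 ℤ.≤ + h ℤ.+ height s i)

up-step : ∀ h x → + h ℤ.+ (step true ℤ.+ x) ≡ + suc h ℤ.+ x
up-step h x = trans (sym (ℤP.+-assoc (+ h) (+ 1) x)) (cong (ℤ._+ x) (cong +_ (ℕP.+-comm h 1)))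

down-step : ∀ h x → + suc h ℤ.+ (step false ℤ.+ x) ≡ + h ℤ.+ x
down-step h x = sym (ℤP.+-assoc (+ suc h) -[1+ 0 ] x)

NonnegTo0-∷ : ∀ {h h′ b s} → (∀ x → + h ℤ.+ (step b ℤ.+ x) ≡ + h′ ℤ.+ x) → NonnegTo0 h (b ∷ s) ⇔ NonnegTo0 h′ s
NonnegTo0-∷ shift = mk⇔
  (λ (end , nonneg) → trans (sym (shift _)) end , λ i i< → subst (+ 0 ℤ.≤_) (shift _) (nonneg (suc i) (s≤s i<)))
  (λ (end , nonneg) → trans (shift _) end , λ
    { zero    _         → ℤ.+≤+ z≤n
    ; (suc i) (s≤s i<) → subst (+ 0 ℤ.≤_) (sym (shift _)) (nonneg i i<) })

¬NonnegTo0-0-down : ∀ s → ¬ NonnegTo0 0 (false ∷ s)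
¬NonnegTo0-0-down []      (() , _)
¬NonnegTo0-0-down (_ ∷ _) (_ , nonneg) with nonneg 1 (s≤s (s≤s z≤n))
... | ()

nonnegTo0≡1⇔ : ∀ h s → nonnegTo0 h s ≡ 1 ⇔ NonnegTo0 h s
nonnegTo0≡1⇔ zero    []          = mk⇔ (λ _ → refl , λ _ ()) (λ _ → refl)
nonnegTo0≡1⇔ (suc h) []          = mk⇔ (λ ()) (λ ())
nonnegTo0≡1⇔ h       (true ∷ s)  = ⇔.trans (nonnegTo0≡1⇔ (suc h) s) (⇔.sym (NonnegTo0-∷ (up-step h)))
nonnegTo0≡1⇔ zero    (false ∷ s) = mk⇔ (λ ()) (⊥-elim ∘ ¬NonnegTo0-0-down s)
nonnegTo0≡1⇔ (suc h) (false ∷ s) = ⇔.trans (nonnegTo0≡1⇔ h s) (⇔.sym (NonnegTo0-∷ (down-step h)))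

nonnegTo0≤1 : ∀ h s → nonnegTo0 h s ≤ 1
nonnegTo0≤1 zero    []          = s≤s z≤n
nonnegTo0≤1 (suc h) []          = z≤n
nonnegTo0≤1 h       (true ∷ s)  = nonnegTo0≤1 (suc h) s
nonnegTo0≤1 zero    (false ∷ s) = z≤n
nonnegTo0≤1 (suc h) (false ∷ s) = nonnegTo0≤1 h s

IsDyck⇔NonnegTo0 : ∀ n s → length s ≡ 2 * n → IsDyck n s ⇔ NonnegTo0 0 s
IsDyck⇔NonnegTo0 n s len rewrite len = mk⇔
  (λ (end , nonneg) → trans (ℤP.+-identityˡ _) end , λ
    { zero    _     → ℤ.+≤+ z≤n
    ; (suc i) 1+i<  → subst (+ 0 ℤ.≤_) (sym (ℤP.+-identityˡ _))
                             (All.applyUpTo⁻ suc (2 * n ∸ 1) nonneg (pred-< 1+i<)) })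
  (λ (end , nonneg) → trans (sym (ℤP.+-identityˡ _)) end ,
    All.applyUpTo⁺₁ suc (2 * n ∸ 1) (λ i< → subst (+ 0 ℤ.≤_) (ℤP.+-identityˡ _) (nonneg _ (suc-< i<))))
  where
  pred-< : ∀ {i m} → suc i < m → i < m ∸ 1
  pred-< {m = suc m} (s≤s i<m) = i<m
  suc-< : ∀ {i m} → i < m ∸ 1 → suc i < m
  suc-< {m = suc m} i<m = s≤s i<m

𝟙-isDyck : ∀ n s → length s ≡ 2 * n → 𝟙[ isDyck? n s ] ≡ nonnegTo0 0 s
𝟙-isDyck n s len =
  𝟙-≡ (isDyck? n s) (nonnegTo0≤1 0 s) (⇔.trans (IsDyck⇔NonnegTo0 n s len) (⇔.sym (nonnegTo0≡1⇔ 0 s)))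

zerosFrom : ℤ → List Bool → ℕ → ℕ
zerosFrom z s n = sum (applyUpTo (λ t → 𝟙[ z ℤ.+ height s (2 * suc t) ℤ.≟ + 0 ]) n)

zeroSetSize≡1+zerosFrom : ∀ n s → zeroSetSize n s ≡ suc (zerosFrom (+ 0) s n)
zeroSetSize≡1+zerosFrom n s = begin
  zeroSetSize n s                                          ≡⟨ length-filter≡sum inZ? (applyUpTo (λ t → t) (suc n)) ⟩
  sum (map (𝟙[_] ∘ inZ?) (applyUpTo (λ t → t) (suc n)))   ≡⟨ cong sum (map-applyUpTo (λ t → t) (𝟙[_] ∘ inZ?) (suc n)) ⟩
  suc (sum (applyUpTo (λ t → 𝟙[ height s (2 * suc t) ℤ.≟ + 0 ]) n))
    ≡⟨ cong (suc ∘ sum) (applyUpTo-cong (λ t → cong (λ x → 𝟙[ x ℤ.≟ + 0 ])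
                                                     (sym (ℤP.+-identityˡ (height s (2 * suc t))))) n) ⟩
  suc (zerosFrom (+ 0) s n)                                ∎
  where
  open ≡-Reasoning
  inZ? : ∀ t → Dec (t ≡ 0 ⊎ height s (2 * t) ≡ + 0)
  inZ? t = (t ℕ.≟ 0) ⊎-dec (height s (2 * t) ℤ.≟ + 0)

data Even : ℕ → Set where
  even-0  : Even 0
  even-2+ : ∀ {h} → Even h → Even (suc (suc h))

zerosFrom-∷∷ : ∀ z b₁ b₂ s n h → (∀ x → z ℤ.+ (step b₁ ℤ.+ (step b₂ ℤ.+ x)) ≡ + h ℤ.+ x) →
               zerosFrom z (b₁ ∷ b₂ ∷ s) (suc n) ≡ 𝟙[ h ℕ.≟ 0 ] + zerosFrom (+ h) s n
zerosFrom-∷∷ z b₁ b₂ s n h shift = cong₂ _+_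
  (cong (λ x → 𝟙[ x ℤ.≟ + 0 ]) (trans (shift (+ 0)) (cong +_ (ℕP.+-identityʳ h))))
  (cong sum (applyUpTo-cong (λ t → cong (λ x → 𝟙[ x ℤ.≟ + 0 ])
     (trans (cong (λ i → z ℤ.+ height (b₁ ∷ b₂ ∷ s) i) (ℕP.*-suc 2 (suc t))) (shift _))) n))

-- From an even height the walk can reach 0 only after an even number of steps, so it suffices to look at
-- the heights after every second step.
returns≡zerosFrom : ∀ n {h} s → Even h → nonnegTo0 h s ≡ 1 → length s ≡ 2 * n → returns h s ≡ zerosFrom (+ h) s n
returns≡zerosFrom zero    []                 _ _ _   = refl
returns≡zerosFrom (suc n) (b₁ ∷ b₂ ∷ s) even path len = two-steps even b₁ b₂ path
  where
  len′ : length s ≡ 2 * n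
  len′ = ℕP.suc-injective (ℕP.suc-injective (trans len (ℕP.*-suc 2 n)))
  rec : ∀ {h} → Even h → nonnegTo0 h s ≡ 1 → returns h s ≡ zerosFrom (+ h) s n
  rec even path = returns≡zerosFrom n s even path len′
  two-steps : ∀ {h} → Even h → ∀ b₁ b₂ → nonnegTo0 h (b₁ ∷ b₂ ∷ s) ≡ 1 →
              returns h (b₁ ∷ b₂ ∷ s) ≡ zerosFrom (+ h) (b₁ ∷ b₂ ∷ s) (suc n)
  two-steps {h} even true true path = trans (rec (even-2+ even) path)
    (sym (zerosFrom-∷∷ (+ h) true true s n (2 + h) (λ x → trans (up-step h (step true ℤ.+ x)) (up-step (suc h) x))))
  two-steps {h} even true false path = trans (cong (𝟙[ h ℕ.≟ 0 ] ℕ.+_) (rec even path))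
    (sym (zerosFrom-∷∷ (+ h) true false s n h (λ x → trans (up-step h (step false ℤ.+ x)) (down-step h x))))
  two-steps even-0 false _ ()
  two-steps (even-2+ {h} even) false true path = trans (rec (even-2+ even) path)
    (sym (zerosFrom-∷∷ (+ (2 + h)) false true s n (2 + h)
                       (λ x → trans (down-step (suc h) (step true ℤ.+ x)) (up-step (suc h) x))))
  two-steps (even-2+ {h} even) false false path = trans (cong (𝟙[ h ℕ.≟ 0 ] ℕ.+_) (rec even path))
    (sym (zerosFrom-∷∷ (+ (2 + h)) false false s n h
                       (λ x → trans (down-step (suc h) (step false ℤ.+ x)) (down-step h x))))
returns≡zerosFrom zero    (_ ∷ _)       _ _ ()
returns≡zerosFrom (suc n) []            _ _ ()
returns≡zerosFrom (suc n) (_ ∷ [])      _ _ len with trans len (ℕP.*-suc 2 n)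
... | ()

𝟙-isDyck-zeroSetSize : ∀ n r s → length s ≡ 2 * n →
                       𝟙[ isDyck? n s ] * 𝟙[ zeroSetSize n s ℕ.≟ suc r ] ≡ withReturns 0 r s
𝟙-isDyck-zeroSetSize n r s len rewrite 𝟙-isDyck n s len with nonnegTo0 0 s in path | nonnegTo0≤1 0 s
... | zero     | _           = refl
... | suc zero | _           = cong (λ z → 1 * 𝟙[ z ℕ.≟ suc r ])
  (trans (zeroSetSize≡1+zerosFrom n s) (cong suc (sym (returns≡zerosFrom n s even-0 path len))))
... | suc (suc _) | s≤s ()

-- Ballot numbers

ballot : ℕ → ℕ → ℕ
ballot zero    h       = 𝟙[ h ℕ.≟ 0 ]
ballot (suc m) zero    = ballot m 1
ballot (suc m) (suc h) = ballot m (suc (suc h)) + ballot m h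

ballotByReturns : ℕ → ℕ → ℕ → ℕ
ballotByReturns zero    h             zero    = 𝟙[ h ℕ.≟ 0 ]
ballotByReturns zero    h             (suc r) = 0
ballotByReturns (suc m) zero          r       = ballotByReturns m 1 r
ballotByReturns (suc m) 1             zero    = ballotByReturns m 2 0
ballotByReturns (suc m) 1             (suc r) = ballotByReturns m 2 (suc r) + ballotByReturns m 0 r
ballotByReturns (suc m) (suc (suc h)) r       = ballotByReturns m (3 + h) r + ballotByReturns m (suc h) r

Σseqs-nonnegTo0 : ∀ m h → Σseqs m (nonnegTo0 h) ≡ ballot m h
Σseqs-nonnegTo0 zero    h       = ℕP.+-identityʳ _
Σseqs-nonnegTo0 (suc m) zero    = begin
  Σseqs (suc m) (nonnegTo0 0)                  ≡⟨ Σseqs-suc m _ ⟩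
  Σseqs m (nonnegTo0 1) + Σseqs m (λ _ → 0)    ≡⟨ cong₂ _+_ (Σseqs-nonnegTo0 m 1) (sum-map-zero (allSeqs m)) ⟩
  ballot m 1 + 0                               ≡⟨ ℕP.+-identityʳ _ ⟩
  ballot m 1                                   ∎
  where open ≡-Reasoning
Σseqs-nonnegTo0 (suc m) (suc h) =
  trans (Σseqs-suc m _) (cong₂ _+_ (Σseqs-nonnegTo0 m (suc (suc h))) (Σseqs-nonnegTo0 m h))

Σseqs-withReturns : ∀ m h r → Σseqs m (withReturns h r) ≡ ballotByReturns m h r
Σseqs-withReturns zero    h       zero    = trans (ℕP.+-identityʳ _) (ℕP.*-identityʳ _)
Σseqs-withReturns zero    h       (suc r) = trans (ℕP.+-identityʳ _) (ℕP.*-zeroʳ (𝟙[ h ℕ.≟ 0 ]))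
Σseqs-withReturns (suc m) zero    r       = trans (Σseqs-suc m _)
  (trans (cong₂ _+_ (Σseqs-withReturns m 1 r) (sum-map-zero (allSeqs m))) (ℕP.+-identityʳ _))
Σseqs-withReturns (suc m) 1       zero    = trans (Σseqs-suc m _)
  (trans (cong₂ _+_ (Σseqs-withReturns m 2 0) no-second-return) (ℕP.+-identityʳ _))
  where
  no-second-return : Σseqs m (λ s → nonnegTo0 0 s * 0) ≡ 0
  no-second-return = trans (cong sum (map-cong (ℕP.*-zeroʳ ∘ nonnegTo0 0) (allSeqs m))) (sum-map-zero (allSeqs m))
Σseqs-withReturns (suc m) 1       (suc r) =
  trans (Σseqs-suc m _) (cong₂ _+_ (Σseqs-withReturns m 2 (suc r)) (Σseqs-withReturns m 0 r))
Σseqs-withReturns (suc m) (suc (suc h)) r  =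
  trans (Σseqs-suc m _) (cong₂ _+_ (Σseqs-withReturns m (3 + h) r) (Σseqs-withReturns m (suc h) r))

length-dyckPaths : ∀ n → length (dyckPaths n) ≡ ballot (2 * n) 0
length-dyckPaths n = begin
  length (dyckPaths n)              ≡⟨ length-filter≡sum (isDyck? n) (allSeqs (2 * n)) ⟩
  Σseqs (2 * n) (𝟙[_] ∘ isDyck? n)  ≡⟨ Σseqs-cong (2 * n) (𝟙-isDyck n) ⟩
  Σseqs (2 * n) (nonnegTo0 0)       ≡⟨ Σseqs-nonnegTo0 (2 * n) 0 ⟩
  ballot (2 * n) 0                  ∎
  where open ≡-Reasoning

count-zeroSetSize : ∀ n r →
  length (filter (λ s → zeroSetSize n s ℕ.≟ suc r) (dyckPaths n)) ≡ ballotByReturns (2 * n) 0 r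
count-zeroSetSize n r = begin
  length (filter zss? (dyckPaths n))
    ≡⟨ length-filter≡sum zss? (dyckPaths n) ⟩
  sum (map (𝟙[_] ∘ zss?) (dyckPaths n))
    ≡⟨ sum-map-filter (isDyck? n) (𝟙[_] ∘ zss?) (allSeqs (2 * n)) ⟩
  Σseqs (2 * n) (λ s → 𝟙[ isDyck? n s ] * 𝟙[ zss? s ])
    ≡⟨ Σseqs-cong (2 * n) (𝟙-isDyck-zeroSetSize n r) ⟩
  Σseqs (2 * n) (withReturns 0 r)
    ≡⟨ Σseqs-withReturns (2 * n) 0 r ⟩
  ballotByReturns (2 * n) 0 r
    ∎
  where
  open ≡-Reasoning
  zss? : ∀ s → Dec (zeroSetSize n s ≡ suc r)
  zss? s = zeroSetSize n s ℕ.≟ suc r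

ballot-< : ∀ {m h} → m < h → ballot m h ≡ 0
ballot-< {zero}  {suc h} _          = refl
ballot-< {suc m} {suc h} (s≤s m<h) = cong₂ _+_ (ballot-< (ℕP.m<n⇒m<1+n (ℕP.m<n⇒m<1+n m<h))) (ballot-< m<h)

ballot-diagonal : ∀ h → ballot h h ≡ 1
ballot-diagonal zero    = refl
ballot-diagonal (suc h) = cong₂ _+_ (ballot-< (ℕP.m<n⇒m<1+n (ℕP.n<1+n h))) (ballot-diagonal h)

ballotByReturns-< : ∀ {m r} h → m < r → ballotByReturns m h r ≡ 0
ballotByReturns-< {zero}  {suc r} h             _   = refl
ballotByReturns-< {suc m}         zero          m<r = ballotByReturns-< 1 (ℕP.<-trans (ℕP.n<1+n m) m<r)
ballotByReturns-< {suc m} {suc r} 1             (s≤s m<r) =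
  cong₂ _+_ (ballotByReturns-< 2 (ℕP.m<n⇒m<1+n m<r)) (ballotByReturns-< 0 m<r)
ballotByReturns-< {suc m} {r}     (suc (suc h)) m<r =
  cong₂ _+_ (ballotByReturns-< (3 + h) m<r′) (ballotByReturns-< (suc h) m<r′)
  where
  m<r′ : m < r
  m<r′ = ℕP.<-trans (ℕP.n<1+n m) m<r

ballotByReturns-no-return : ∀ m h → ballotByReturns m (suc h) 0 ≡ 0
ballotByReturns-no-return zero    h             = refl
ballotByReturns-no-return (suc m) zero          = ballotByReturns-no-return m 1
ballotByReturns-no-return (suc m) (suc h)       =
  cong₂ _+_ (ballotByReturns-no-return m (suc (suc h))) (ballotByReturns-no-return m h)

ballotByReturns≡ballot : ∀ m h r → ballotByReturns (suc (m + r)) (suc h) (suc r) ≡ ballot m (h + r)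
ballotByReturns≡ballot zero    (suc h) r       =
  cong₂ _+_ (ballotByReturns-< (3 + h) (ℕP.n<1+n r)) (ballotByReturns-< (suc h) (ℕP.n<1+n r))
ballotByReturns≡ballot (suc m) (suc h) r       =
  cong₂ _+_ (ballotByReturns≡ballot m (suc (suc h)) r) (ballotByReturns≡ballot m h r)
ballotByReturns≡ballot zero    zero    zero    = refl
ballotByReturns≡ballot zero    zero    (suc r) =
  cong₂ _+_ (ballotByReturns-< 2 (ℕP.n<1+n (suc r))) (ballotByReturns-< 1 (ℕP.n<1+n r))
ballotByReturns≡ballot (suc m) zero    zero    =
  trans (cong₂ _+_ (ballotByReturns≡ballot m 1 0) (ballotByReturns-no-return (m + 0) 0)) (ℕP.+-identityʳ _)
ballotByReturns≡ballot (suc m) zero    (suc r) = cong₂ _+_ (ballotByReturns≡ballot m 1 (suc r))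
  (trans (cong (λ x → ballotByReturns x 1 (suc r)) (ℕP.+-suc m r)) (ballotByReturns≡ballot m 0 r))

count-returns : ∀ u i → length (filter (λ s → zeroSetSize (2 + u + i) s ℕ.≟ 2 + i) (dyckPaths (2 + u + i)))
                        ≡ ballot (2 + u + u + i) i
count-returns u i = begin
  length (filter (λ s → zeroSetSize (2 + u + i) s ℕ.≟ 2 + i) (dyckPaths (2 + u + i)))
    ≡⟨ count-zeroSetSize (2 + u + i) (suc i) ⟩
  ballotByReturns (2 * (2 + u + i)) 0 (suc i)
    ≡⟨ cong (λ m → ballotByReturns m 0 (suc i)) (lemma u i) ⟩
  ballotByReturns (suc (suc (2 + u + u + i + i))) 0 (suc i)
    ≡⟨ ballotByReturns≡ballot (2 + u + u + i) 0 i ⟩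
  ballot (2 + u + u + i) i
    ∎
  where
  open ≡-Reasoning
  lemma : ∀ u i → 2 * (2 + u + i) ≡ suc (suc (2 + u + u + i + i))
  lemma = solve-∀

-- Binomial coefficients

-- _C_ (infixl 6.5) binds more loosely than _*_, hence the parentheses around binomials below.
pascal : ∀ n k → suc n C suc k ≡ n C k + n C suc k
pascal n k = sym (nCk+nC[k+1]≡[n+1]C[k+1] n k)

C-pos : ∀ {n k} → k ≤ n → 0 < n C k
C-pos {n}     {zero}  _          = s≤s z≤n
C-pos {suc n} {suc k} (s≤s k≤n) = subst (0 <_) (sym (pascal n k)) (ℕP.<-≤-trans (C-pos k≤n) (ℕP.m≤m+n _ _))

C-absorption : ∀ n k → (suc n C suc k) * suc k ≡ (n C k) * suc n
C-absorption zero    zero    = refl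
C-absorption zero    (suc k) = refl
C-absorption (suc n) zero    = begin
  ((2 + n) C 1) * 1        ≡⟨ ℕP.*-identityʳ ((2 + n) C 1) ⟩
  (2 + n) C 1              ≡⟨ nC1≡n (2 + n) ⟩
  2 + n                    ≡⟨ ℕP.*-identityˡ (2 + n) ⟨
  ((1 + n) C 0) * (2 + n)  ∎
  where open ≡-Reasoning
C-absorption (suc n) (suc k) = begin
  ((2 + n) C (2 + k)) * (2 + k)
    ≡⟨ cong (_* (2 + k)) (pascal (suc n) (suc k)) ⟩
  ((1 + n) C (1 + k) + (1 + n) C (2 + k)) * (2 + k)
    ≡⟨ expand ((1 + n) C (1 + k)) ((1 + n) C (2 + k)) k ⟩
  ((1 + n) C (1 + k)) * (1 + k) + (1 + n) C (1 + k) + ((1 + n) C (2 + k)) * (2 + k)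
    ≡⟨ cong₃ (λ x y z → x + y + z) (C-absorption n k) (pascal n k) (C-absorption n (suc k)) ⟩
  (n C k) * (1 + n) + (n C k + n C (1 + k)) + (n C (1 + k)) * (1 + n)
    ≡⟨ collect (n C k) (n C (1 + k)) n ⟩
  (n C k + n C (1 + k)) * (2 + n)
    ≡⟨ cong (_* (2 + n)) (pascal n k) ⟨
  ((1 + n) C (1 + k)) * (2 + n)
    ∎
  where
  open ≡-Reasoning
  cong₃ : ∀ (f : ℕ → ℕ → ℕ → ℕ) {x x′ y y′ z z′} → x ≡ x′ → y ≡ y′ → z ≡ z′ → f x y z ≡ f x′ y′ z′
  cong₃ f refl refl refl = refl
  expand : ∀ a b k → (a + b) * (2 + k) ≡ a * (1 + k) + a + b * (2 + k)
  expand = solve-∀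
  collect : ∀ a b n → a * (1 + n) + (a + b) + b * (1 + n) ≡ (a + b) * (2 + n)
  collect = solve-∀

C-sym : ∀ a b → (a + b) C a ≡ (a + b) C b
C-sym a b = trans (nCk≡nC[n∸k] (ℕP.m≤m+n a b)) (cong ((a + b) C_) (ℕP.m+n∸m≡n a b))

C-absorption-complement : ∀ k a → (suc (k + a) C k) * suc a ≡ ((k + a) C k) * suc (k + a)
C-absorption-complement k a = begin
  (suc (k + a) C k) * suc a      ≡⟨ cong (λ n → (n C k) * suc a) (ℕP.+-suc k a) ⟨
  ((k + suc a) C k) * suc a      ≡⟨ cong (_* suc a) (C-sym k (suc a)) ⟩
  ((k + suc a) C suc a) * suc a  ≡⟨ cong (λ n → (n C suc a) * suc a) (ℕP.+-suc k a) ⟩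
  (suc (k + a) C suc a) * suc a  ≡⟨ C-absorption (k + a) a ⟩
  ((k + a) C a) * suc (k + a)    ≡⟨ cong (_* suc (k + a)) (C-sym k a) ⟨
  ((k + a) C k) * suc (k + a)    ∎
  where open ≡-Reasoning

C-absorption-shift : ∀ j a → (suc (j + a) C suc j) * suc j ≡ (suc (j + a) C j) * suc a
C-absorption-shift j a = trans (C-absorption (j + a) j) (sym (C-absorption-complement j a))

rising : ℕ → ℕ → ℕ
rising a t = product (applyUpTo (λ i → a + i) t)

rising-suc : ∀ a t → rising a (suc t) ≡ a * rising (suc a) t
rising-suc a t = cong₂ _*_ (ℕP.+-identityʳ a) (cong product (applyUpTo-cong (ℕP.+-suc a) t))

C-absorption-rising : ∀ t n k → ((n + t) C (k + t)) * rising (suc k) t ≡ (n C k) * rising (suc n) t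
C-absorption-rising zero    n k = cong₂ (λ n k → (n C k) * 1) (ℕP.+-identityʳ n) (ℕP.+-identityʳ k)
C-absorption-rising (suc t) n k = begin
  ((n + suc t) C (k + suc t)) * rising (suc k) (suc t)
    ≡⟨ cong₂ (λ a b → (a C b) * rising (suc k) (suc t)) (ℕP.+-suc n t) (ℕP.+-suc k t) ⟩
  ((suc n + t) C (suc k + t)) * rising (suc k) (suc t)
    ≡⟨ cong (((suc n + t) C (suc k + t)) *_) (rising-suc (suc k) t) ⟩
  ((suc n + t) C (suc k + t)) * (suc k * rising (2 + k) t)
    ≡⟨ *-CS.x∙yz≈y∙xz ((suc n + t) C (suc k + t)) (suc k) (rising (2 + k) t) ⟩
  suc k * (((suc n + t) C (suc k + t)) * rising (2 + k) t)
    ≡⟨ cong (suc k *_) (C-absorption-rising t (suc n) (suc k)) ⟩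
  suc k * ((suc n C suc k) * rising (2 + n) t)
    ≡⟨ *-CS.x∙yz≈yx∙z (suc k) (suc n C suc k) (rising (2 + n) t) ⟩
  ((suc n C suc k) * suc k) * rising (2 + n) t
    ≡⟨ cong (_* rising (2 + n) t) (C-absorption n k) ⟩
  ((n C k) * suc n) * rising (2 + n) t
    ≡⟨ ℕP.*-assoc (n C k) (suc n) (rising (2 + n) t) ⟩
  (n C k) * (suc n * rising (2 + n) t)
    ≡⟨ cong ((n C k) *_) (rising-suc (suc n) t) ⟨
  (n C k) * rising (suc n) (suc t)
    ∎
  where open ≡-Reasoning

-- Reflection principle: ballot X h = X C (u + 1) − X C u, where u + 1 is the number of up-steps.
ballot-reflection : ∀ X u h → X ≡ 2 + u + u + h → ballot X h + X C u ≡ X C suc u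
ballot-reflection (suc X) zero    zero    refl = refl
ballot-reflection (suc X) (suc u) zero    eq   = begin
  ballot X 1 + suc X C suc u          ≡⟨ cong (λ z → ballot X 1 + z) (pascal X u) ⟩
  ballot X 1 + (X C u + X C suc u)    ≡⟨ ℕP.+-assoc (ballot X 1) _ _ ⟨
  ballot X 1 + X C u + X C suc u      ≡⟨ cong (_+ (X C suc u)) (ballot-reflection X u 1 X≡) ⟩
  X C suc u + X C suc u               ≡⟨ cong (λ z → X C suc u + z) central ⟩
  X C suc u + X C (2 + u)             ≡⟨ pascal X (suc u) ⟨
  suc X C (2 + u)                     ∎
  where
  open ≡-Reasoning
  X≡ : X ≡ 2 + u + u + 1
  X≡ = trans (ℕP.suc-injective eq) (lemma u)
    where lemma : ∀ u → 1 + suc u + suc u + 0 ≡ 2 + u + u + 1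
          lemma = solve-∀
  central : X C suc u ≡ X C (2 + u)
  central = subst (λ n → n C suc u ≡ n C (2 + u)) (sym (trans X≡ (lemma u))) (C-sym (suc u) (2 + u))
    where lemma : ∀ u → 2 + u + u + 1 ≡ suc u + (2 + u)
          lemma = solve-∀
ballot-reflection (suc X) zero    (suc h) eq   = begin
  ballot X (2 + h) + ballot X h + suc X C 0  ≡⟨ cong (λ b → b + ballot X h + 1) diagonal ⟩
  1 + ballot X h + 1                        ≡⟨ cong suc (ballot-reflection X 0 h X≡) ⟩
  1 + X C 1                                 ≡⟨ pascal X 0 ⟨
  suc X C 1                                 ∎
  where
  open ≡-Reasoning
  X≡ : X ≡ 2 + h
  X≡ = ℕP.suc-injective eq
  diagonal : ballot X (2 + h) ≡ 1
  diagonal = trans (cong (λ m → ballot m (2 + h)) X≡) (ballot-diagonal (2 + h))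
ballot-reflection (suc X) (suc u) (suc h) eq   = begin
  ballot X (2 + h) + ballot X h + suc X C suc u
    ≡⟨ cong (λ z → ballot X (2 + h) + ballot X h + z) (pascal X u) ⟩
  ballot X (2 + h) + ballot X h + (X C u + X C suc u)
    ≡⟨ +-CS.interchange (ballot X (2 + h)) _ _ _ ⟩
  (ballot X (2 + h) + X C u) + (ballot X h + X C suc u)
    ≡⟨ cong₂ _+_ (ballot-reflection X u (2 + h) (trans X≡ (lemma u h))) (ballot-reflection X (suc u) h X≡) ⟩
  X C suc u + X C (2 + u)
    ≡⟨ pascal X (suc u) ⟨
  suc X C (2 + u)
    ∎
  where
  open ≡-Reasoning
  X≡ : X ≡ 2 + suc u + suc u + h
  X≡ = ℕP.suc-injective (trans eq (cong (λ z → 2 + z) (ℕP.+-suc (suc u + suc u) h)))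
  lemma : ∀ u h → 2 + suc u + suc u + h ≡ 2 + u + u + (2 + h)
  lemma = solve-∀

ballot-formula : ∀ u h → ballot (2 + u + u + h) h * suc u ≡ ((2 + u + u + h) C u) * suc h
ballot-formula u h = ℕP.+-cancelʳ-≡ ((X C u) * suc u) _ _ (begin
  ballot X h * suc u + (X C u) * suc u  ≡⟨ ℕP.*-distribʳ-+ (suc u) (ballot X h) (X C u) ⟨
  (ballot X h + X C u) * suc u          ≡⟨ cong (_* suc u) (ballot-reflection X u h refl) ⟩
  (X C suc u) * suc u                   ≡⟨ subst (λ n → (n C suc u) * suc u ≡ (n C u) * (2 + u + h)) X≡
                                                 (C-absorption-shift u (suc (u + h))) ⟩
  (X C u) * (2 + u + h)                 ≡⟨ cong ((X C u) *_) (lemma u h) ⟩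
  (X C u) * (suc h + suc u)             ≡⟨ ℕP.*-distribˡ-+ (X C u) (suc h) (suc u) ⟩
  (X C u) * suc h + (X C u) * suc u     ∎)
  where
  open ≡-Reasoning
  X : ℕ
  X = 2 + u + u + h
  X≡ : suc (u + suc (u + h)) ≡ X
  X≡ = cong suc (trans (ℕP.+-suc u (u + h)) (cong suc (sym (ℕP.+-assoc u u h))))
  lemma : ∀ u h → 2 + u + h ≡ suc h + suc u
  lemma = solve-∀

catalan : ∀ N → ballot (2 * suc N) 0 * suc N ≡ suc (N + suc N) C N
catalan N = begin
  ballot (2 * suc N) 0 * suc N      ≡⟨ cong (λ m → ballot m 0 * suc N) (lemma₁ N) ⟨
  ballot (2 + N + N + 0) 0 * suc N  ≡⟨ ballot-formula N 0 ⟩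
  ((2 + N + N + 0) C N) * 1         ≡⟨ ℕP.*-identityʳ _ ⟩
  (2 + N + N + 0) C N               ≡⟨ cong (_C N) (lemma₂ N) ⟩
  suc (N + suc N) C N               ∎
  where
  open ≡-Reasoning
  lemma₁ : ∀ N → 2 + N + N + 0 ≡ 2 * suc N
  lemma₁ = solve-∀
  lemma₂ : ∀ N → 2 + N + N + 0 ≡ suc (N + suc N)
  lemma₂ = solve-∀

catalan-pos : ∀ n → 0 < ballot (2 * n) 0
catalan-pos zero    = s≤s z≤n
catalan-pos (suc N) = ℕP.*-cancelʳ-< (suc N) 0 _ (subst (0 <_) (sym (catalan N)) (C-pos N≤1+N+1+N))
  where
  N≤1+N+1+N : N ≤ suc (N + suc N)
  N≤1+N+1+N = ℕP.m≤n⇒m≤1+n (ℕP.m≤m+n N (suc N))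

-- For n = 2 + u + i, ballot (2 + u + u + i) i counts the Dyck paths of length 2n with i + 1 returns to 0
-- (count-returns) and ballot (2 * n) 0 all of them (length-dyckPaths).
ratio-identity : ∀ u i →
  ballot (2 + u + u + i) i * 2 ^ (2 + i) * rising (3 + u + u + i) (suc i)
  ≡ suc i * ballot (2 * (2 + u + i)) 0 * (2 * (3 + u + i) * (2 ^ i * rising (2 + u) i))
ratio-identity u i = ℕP.*-cancelʳ-≡ _ _ (suc u * suc N) (trans lhs≡ (sym rhs≡))
  where
  open ≡-Reasoning
  M₀ N X₁ E D ρ R Q : ℕ
  M₀ = 2 + u + u + i
  N  = u + suc i
  X₁ = N + suc N
  E  = ballot M₀ i
  D  = ballot (2 * (2 + u + i)) 0
  ρ  = rising (2 + u) i
  R  = rising (suc M₀) (suc i)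
  Q  = suc i * 2 ^ (2 + i) * suc N * ((X₁ C N) * (suc u * ρ))

  D*N≡C : D * suc N ≡ suc X₁ C N
  D*N≡C = trans (cong (λ m → ballot m 0 * suc N) (lemma u i)) (catalan N)
    where
    lemma : ∀ u i → 2 * (2 + u + i) ≡ 2 * suc (u + suc i)
    lemma = solve-∀

  shift-M₀ : (X₁ C N) * (suc u * ρ) ≡ (M₀ C u) * R
  shift-M₀ = begin
    (X₁ C N) * (suc u * ρ)                       ≡⟨ cong ((X₁ C N) *_) (rising-suc (suc u) i) ⟨
    (X₁ C N) * rising (suc u) (suc i)            ≡⟨ cong (λ m → (m C N) * rising (suc u) (suc i)) (lemma u i) ⟩
    ((M₀ + suc i) C N) * rising (suc u) (suc i)  ≡⟨ C-absorption-rising (suc i) M₀ u ⟩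
    (M₀ C u) * R                                 ∎
    where
    lemma : ∀ u i → u + suc i + suc (u + suc i) ≡ 2 + u + u + i + suc i
    lemma = solve-∀

  lhs≡ : E * 2 ^ (2 + i) * R * (suc u * suc N) ≡ Q
  lhs≡ = begin
    E * 2 ^ (2 + i) * R * (suc u * suc N)          ≡⟨ rearrange₁ E (2 ^ i) R (suc u) (suc N) ⟩
    (E * suc u) * (2 ^ (2 + i) * suc N * R)        ≡⟨ cong (_* (2 ^ (2 + i) * suc N * R)) (ballot-formula u i) ⟩
    ((M₀ C u) * suc i) * (2 ^ (2 + i) * suc N * R) ≡⟨ rearrange₂ (M₀ C u) (suc i) (2 ^ i) (suc N) R ⟩
    suc i * 2 ^ (2 + i) * suc N * ((M₀ C u) * R)   ≡⟨ cong (suc i * 2 ^ (2 + i) * suc N *_) shift-M₀ ⟨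
    Q                                              ∎
    where
    rearrange₁ : ∀ e p r a b → e * (2 * (2 * p)) * r * (a * b) ≡ (e * a) * (2 * (2 * p) * b * r)
    rearrange₁ = solve-∀
    rearrange₂ : ∀ c s p b r → (c * s) * (2 * (2 * p) * b * r) ≡ s * (2 * (2 * p)) * b * (c * r)
    rearrange₂ = solve-∀

  rhs≡ : suc i * D * (2 * (3 + u + i) * (2 ^ i * ρ)) * (suc u * suc N) ≡ Q
  rhs≡ = begin
    suc i * D * (2 * (3 + u + i) * (2 ^ i * ρ)) * (suc u * suc N)
      ≡⟨ cong (λ m → suc i * D * (2 * m * (2 ^ i * ρ)) * (suc u * suc N)) (sym (ℕP.+-suc (2 + u) i)) ⟩
    suc i * D * (2 * (2 + N) * (2 ^ i * ρ)) * (suc u * suc N)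
      ≡⟨ rearrange₁ (suc i) D (2 + N) (2 ^ i) ρ (suc u) (suc N) ⟩
    suc i * ((D * suc N) * (2 + N)) * (2 * 2 ^ i * suc u * ρ)
      ≡⟨ cong (λ c → suc i * (c * (2 + N)) * (2 * 2 ^ i * suc u * ρ)) D*N≡C ⟩
    suc i * ((suc X₁ C N) * (2 + N)) * (2 * 2 ^ i * suc u * ρ)
      ≡⟨ cong (λ c → suc i * c * (2 * 2 ^ i * suc u * ρ)) (C-absorption-complement N (suc N)) ⟩
    suc i * ((X₁ C N) * suc X₁) * (2 * 2 ^ i * suc u * ρ)
      ≡⟨ rearrange₂ (suc i) (X₁ C N) N (2 ^ i) (suc u) ρ ⟩
    Q ∎
    where
    rearrange₁ : ∀ s d m p r a b → s * d * (2 * m * (p * r)) * (a * b) ≡ s * ((d * b) * m) * (2 * p * a * r)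
    rearrange₁ = solve-∀
    rearrange₂ : ∀ s c N p a r → s * (c * suc (N + suc N)) * (2 * p * a * r) ≡ s * (2 * (2 * p)) * suc N * (c * (a * r))
    rearrange₂ = solve-∀

-- Products of nearly equal factors

product-applyUpTo-* : ∀ c f t → product (applyUpTo (λ i → c * f i) t) ≡ c ^ t * product (applyUpTo f t)
product-applyUpTo-* c f zero    = refl
product-applyUpTo-* c f (suc t) = begin
  c * f 0 * product (applyUpTo (λ i → c * f (suc i)) t)  ≡⟨ cong (c * f 0 *_) (product-applyUpTo-* c (f ∘ suc) t) ⟩
  c * f 0 * (c ^ t * product (applyUpTo (f ∘ suc) t))    ≡⟨ ℕP.[m*n]*[o*p]≡[m*o]*[n*p] c (f 0) (c ^ t) _ ⟩
  c * c ^ t * (f 0 * product (applyUpTo (f ∘ suc) t))    ∎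
  where open ≡-Reasoning

^≤product : ∀ t {L} f → (∀ i → i < t → L ≤ f i) → L ^ t ≤ product (applyUpTo f t)
^≤product zero    f L≤f = ℕP.≤-refl
^≤product (suc t) f L≤f = ℕP.*-mono-≤ (L≤f 0 (s≤s z≤n)) (^≤product t (f ∘ suc) (λ i i<t → L≤f (suc i) (s≤s i<t)))

product≤^ : ∀ t {M} f → (∀ i → i < t → f i ≤ M) → product (applyUpTo f t) ≤ M ^ t
product≤^ zero    f f≤M = ℕP.≤-refl
product≤^ (suc t) f f≤M = ℕP.*-mono-≤ (f≤M 0 (s≤s z≤n)) (product≤^ t (f ∘ suc) (λ i i<t → f≤M (suc i) (s≤s i<t)))

∣product-product∣ : ∀ t {c M} f g → (∀ i → i < t → ∣ f i - g i ∣ ≤ c) →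
                    (∀ i → i < t → f i ≤ M) → (∀ i → i < t → g i ≤ M) →
                    ∣ product (applyUpTo f t) - product (applyUpTo g t) ∣ * M ≤ t * c * M ^ t
∣product-product∣ zero    f g _ _ _ = z≤n
∣product-product∣ (suc t) {c} {M} f g ∣f-g∣≤c f≤M g≤M = begin
  ∣ f 0 * F - g 0 * G ∣ * M
    ≤⟨ ℕP.*-monoˡ-≤ M (ℕP.∣-∣-triangle (f 0 * F) (f 0 * G) (g 0 * G)) ⟩
  (∣ f 0 * F - f 0 * G ∣ + ∣ f 0 * G - g 0 * G ∣) * M
    ≡⟨ cong₂ (λ x y → (x + y) * M) (ℕP.*-distribˡ-∣-∣ (f 0) F G) (ℕP.*-distribʳ-∣-∣ G (f 0) (g 0)) ⟨
  (f 0 * ∣ F - G ∣ + ∣ f 0 - g 0 ∣ * G) * M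
    ≡⟨ distribute (f 0) ∣ F - G ∣ ∣ f 0 - g 0 ∣ G M ⟩
  f 0 * (∣ F - G ∣ * M) + ∣ f 0 - g 0 ∣ * (G * M)
    ≤⟨ ℕP.+-mono-≤
         (ℕP.*-mono-≤ (f≤M 0 (s≤s z≤n)) (∣product-product∣ t (f ∘ suc) (g ∘ suc) (shift ∣f-g∣≤c) (shift f≤M) (shift g≤M)))
         (ℕP.*-mono-≤ (∣f-g∣≤c 0 (s≤s z≤n)) (ℕP.*-monoˡ-≤ M (product≤^ t (g ∘ suc) (shift g≤M)))) ⟩
  M * (t * c * M ^ t) + c * (M ^ t * M)
    ≡⟨ collect M t c (M ^ t) ⟩
  suc t * c * M ^ suc t
    ∎
  where
  open ℕP.≤-Reasoning
  F G : ℕ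
  F = product (applyUpTo (f ∘ suc) t)
  G = product (applyUpTo (g ∘ suc) t)
  shift : ∀ {P : ℕ → Set} → (∀ i → i < suc t → P i) → ∀ i → i < t → P (suc i)
  shift P i i<t = P (suc i) (s≤s i<t)
  distribute : ∀ a d e b m → (a * d + e * b) * m ≡ a * (d * m) + e * (b * m)
  distribute = solve-∀
  collect : ∀ m t c p → m * (t * c * p) + c * (p * m) ≡ suc t * c * (m * p)
  collect = solve-∀

∣-∣≤-of-ratio : ∀ A B P₁ P₂ M W .{{_ : ℕ.NonZero P₂}} → A * P₂ ≡ B * P₁ → ∣ P₁ - P₂ ∣ * M ≤ W * P₂ →
            ∣ A - B ∣ * M ≤ B * W
∣-∣≤-of-ratio A B P₁ P₂ M W AP₂≡BP₁ ∣P₁-P₂∣M≤WP₂ = ℕP.*-cancelʳ-≤ _ _ P₂ (begin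
  ∣ A - B ∣ * M * P₂            ≡⟨ *-CS.xy∙z≈xz∙y ∣ A - B ∣ M P₂ ⟩
  ∣ A - B ∣ * P₂ * M            ≡⟨ cong (_* M) (ℕP.*-distribʳ-∣-∣ P₂ A B) ⟩
  ∣ A * P₂ - B * P₂ ∣ * M       ≡⟨ cong (λ x → ∣ x - B * P₂ ∣ * M) AP₂≡BP₁ ⟩
  ∣ B * P₁ - B * P₂ ∣ * M       ≡⟨ cong (_* M) (ℕP.*-distribˡ-∣-∣ B P₁ P₂) ⟨
  B * ∣ P₁ - P₂ ∣ * M           ≡⟨ ℕP.*-assoc B _ M ⟩
  B * (∣ P₁ - P₂ ∣ * M)         ≤⟨ ℕP.*-monoʳ-≤ B ∣P₁-P₂∣M≤WP₂ ⟩
  B * (W * P₂)                  ≡⟨ ℕP.*-assoc B W P₂ ⟨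
  B * W * P₂                    ∎)
  where open ℕP.≤-Reasoning

∣-∣≤-interval : ∀ {L c a b} → L ≤ a → a ≤ L + c → L ≤ b → b ≤ L + c → ∣ a - b ∣ ≤ c
∣-∣≤-interval {L} {c} {a} {b} L≤a a≤L+c L≤b b≤L+c with ℕP.∣m-n∣≡[m∸n]∨[n∸m] a b
... | inj₁ ∣a-b∣≡a∸b = subst (_≤ c) (sym ∣a-b∣≡a∸b) (subst (a ∸ b ≤_) (ℕP.m+n∸m≡n L c) (ℕP.∸-mono a≤L+c L≤b))
... | inj₂ ∣a-b∣≡b∸a = subst (_≤ c) (sym ∣a-b∣≡b∸a) (subst (b ∸ a ≤_) (ℕP.m+n∸m≡n L c) (ℕP.∸-mono b≤L+c L≤a))

m*o≤n*k⇒k*q<o⇒m*q<n : ∀ {m n k o} q → m * o ≤ n * k → k * q < o → .{{_ : ℕ.NonZero n}} → m * q < n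
m*o≤n*k⇒k*q<o⇒m*q<n {m} {n} {k} {o} q mo≤nk kq<o = ℕP.*-cancelʳ-< o (m * q) n (begin-strict
  m * q * o    ≡⟨ *-CS.xy∙z≈xz∙y m q o ⟩
  m * o * q    ≤⟨ ℕP.*-monoˡ-≤ q mo≤nk ⟩
  n * k * q    ≡⟨ ℕP.*-assoc n k q ⟩
  n * (k * q)  <⟨ ℕP.*-monoʳ-< n kq<o ⟩
  n * o        ∎)
  where open ℕP.≤-Reasoning

-- The error estimate

numFactor : ℕ → ℕ → ℕ → ℕ
numFactor u i zero    = 2 * (3 + u + i)
numFactor u i (suc t) = 2 * (2 + u + t)

denFactor : ℕ → ℕ → ℕ → ℕ
denFactor u i t = 3 + u + u + i + t

product-numFactor : ∀ u i → product (applyUpTo (numFactor u i) (suc i)) ≡ 2 * (3 + u + i) * (2 ^ i * rising (2 + u) i)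
product-numFactor u i = cong (2 * (3 + u + i) *_) (product-applyUpTo-* 2 (λ t → 2 + u + t) i)

numFactor-bounds : ∀ u i t → t < suc i → 3 + u + u ≤ numFactor u i t × numFactor u i t ≤ 3 + u + u + (3 + i + i)
numFactor-bounds u i zero    _ = m+o≡n⇒m≤n (3 + i + i) (lemma u i) , ℕP.≤-reflexive (sym (lemma u i))
  where lemma : ∀ u i → 3 + u + u + (3 + i + i) ≡ 2 * (3 + u + i)
        lemma = solve-∀
numFactor-bounds u i (suc t) (s≤s t<i) with ℕP.m≤n⇒∃[o]m+o≡n t<i
... | j , refl = m+o≡n⇒m≤n (1 + t + t) (lemma₁ u t) , m+o≡n⇒m≤n (4 + j + j) (lemma₂ u t j)
  where lemma₁ : ∀ u t → 3 + u + u + (1 + t + t) ≡ 2 * (2 + u + t)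
        lemma₁ = solve-∀
        lemma₂ : ∀ u t j → 2 * (2 + u + t) + (4 + j + j) ≡ 3 + u + u + (3 + suc t + j + (suc t + j))
        lemma₂ = solve-∀

denFactor-bounds : ∀ u i t → t < suc i → 3 + u + u ≤ denFactor u i t × denFactor u i t ≤ 3 + u + u + (3 + i + i)
denFactor-bounds u i t t<1+i with ℕP.m≤n⇒∃[o]m+o≡n t<1+i
... | j , refl = m+o≡n⇒m≤n (t + j + t) (lemma₁ u t j) , m+o≡n⇒m≤n (3 + j) (lemma₂ u t j)
  where lemma₁ : ∀ u t j → 3 + u + u + (t + j + t) ≡ 3 + u + u + (t + j) + t
        lemma₁ = solve-∀
        lemma₂ : ∀ u t j → 3 + u + u + (t + j) + t + (3 + j) ≡ 3 + u + u + (3 + (t + j) + (t + j))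
        lemma₂ = solve-∀

errorFactor : ℕ → ℕ
errorFactor i = suc i * (suc i * (3 + i + i) * 2 ^ suc i)

ratio-estimate : ∀ u i →
  ∣ ballot (2 + u + u + i) i * 2 ^ (2 + i) - suc i * ballot (2 * (2 + u + i)) 0 ∣ * (2 * (3 + u + i))
  ≤ ballot (2 * (2 + u + i)) 0 * errorFactor i
ratio-estimate u i = subst (∣ A - B ∣ * M ≤_) (*-CS.xy∙z≈y∙xz (suc i) (ballot (2 * (2 + u + i)) 0) W)
  (∣-∣≤-of-ratio A B P₁ P₂ M W {{ℕ.>-nonZero P₂>0}}
    (trans (ratio-identity u i) (cong (B *_) (sym (product-numFactor u i)))) ∣P₁-P₂∣*M≤W*P₂)
  where
  open ℕP.≤-Reasoning
  A B L c M W P₁ P₂ : ℕ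
  A  = ballot (2 + u + u + i) i * 2 ^ (2 + i)
  B  = suc i * ballot (2 * (2 + u + i)) 0
  L  = 3 + u + u
  c  = 3 + i + i
  M  = 2 * (3 + u + i)
  W  = suc i * c * 2 ^ suc i
  P₁ = product (applyUpTo (numFactor u i) (suc i))
  P₂ = rising (3 + u + u + i) (suc i)

  L+c≡M : L + c ≡ M
  L+c≡M = lemma u i
    where lemma : ∀ u i → 3 + u + u + (3 + i + i) ≡ 2 * (3 + u + i)
          lemma = solve-∀

  M≤2*denFactor : ∀ t → M ≤ 2 * denFactor u i t
  M≤2*denFactor t = m+o≡n⇒m≤n (u + u + t + t) (lemma u i t)
    where lemma : ∀ u i t → 2 * (3 + u + i) + (u + u + t + t) ≡ 2 * (3 + u + u + i + t)
          lemma = solve-∀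

  P₂>0 : P₂ > 0
  P₂>0 = ℕP.<-≤-trans (ℕP.m^n>0 L (suc i))
                      (^≤product (suc i) (denFactor u i) (λ t t<1+i → proj₁ (denFactor-bounds u i t t<1+i)))

  ∣P₁-P₂∣*M≤W*P₂ : ∣ P₁ - P₂ ∣ * M ≤ W * P₂
  ∣P₁-P₂∣*M≤W*P₂ = begin
    ∣ P₁ - P₂ ∣ * M
      ≤⟨ ∣product-product∣ (suc i) (numFactor u i) (denFactor u i) ∣num-den∣≤c
           (λ t t< → ≤M (proj₂ (numFactor-bounds u i t t<))) (λ t t< → ≤M (proj₂ (denFactor-bounds u i t t<))) ⟩
    suc i * c * M ^ suc i
      ≤⟨ ℕP.*-monoʳ-≤ (suc i * c) (^≤product (suc i) (λ t → 2 * denFactor u i t) (λ t _ → M≤2*denFactor t)) ⟩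
    suc i * c * product (applyUpTo (λ t → 2 * denFactor u i t) (suc i))
      ≡⟨ cong (suc i * c *_) (product-applyUpTo-* 2 (denFactor u i) (suc i)) ⟩
    suc i * c * (2 ^ suc i * P₂)
      ≡⟨ ℕP.*-assoc (suc i * c) (2 ^ suc i) P₂ ⟨
    W * P₂
      ∎
    where
    ≤M : ∀ {a} → a ≤ L + c → a ≤ M
    ≤M {a} a≤L+c = subst (a ≤_) L+c≡M a≤L+c
    ∣num-den∣≤c : ∀ t → t < suc i → ∣ numFactor u i t - denFactor u i t ∣ ≤ c
    ∣num-den∣≤c t t< = let (L≤n , n≤) = numFactor-bounds u i t t< ; (L≤d , d≤) = denFactor-bounds u i t t< in
                       ∣-∣≤-interval L≤n n≤ L≤d d≤

uniformProb≡ : ∀ {A : Set} {P : A → Set} (P? : ∀ a → Dec (P a)) xs .{{_ : ℕ.NonZero (length xs)}} →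
               uniformProb P? xs ≡ + length (filter P? xs) ℚ./ length xs
uniformProb≡ P? xs with length xs
... | suc m = refl

∣m⊖n∣≡∣m-n∣ : ∀ m n → ℤ.∣ m ℤ.⊖ n ∣ ≡ ∣ m - n ∣
∣m⊖n∣≡∣m-n∣ m n with ℕP.≤-total m n
... | inj₁ m≤n = trans (ℤP.∣⊖∣-≤ m≤n) (sym (ℕP.m≤n⇒∣m-n∣≡n∸m m≤n))
... | inj₂ n≤m = begin
  ℤ.∣ m ℤ.⊖ n ∣  ≡⟨ ℤP.∣m⊖n∣≡∣n⊖m∣ m n ⟩
  ℤ.∣ n ℤ.⊖ m ∣  ≡⟨ ℤP.∣⊖∣-≤ n≤m ⟩
  m ∸ n          ≡⟨ ℕP.m≤n⇒∣m-n∣≡n∸m n≤m ⟨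
  ∣ n - m ∣      ≡⟨ ℕP.∣-∣-comm n m ⟩
  ∣ m - n ∣      ∎
  where open ≡-Reasoning

-- The comparison is carried out on unnormalised rationals, where it is cross-multiplication.
∣e/D-r/d∣< : ∀ e D r d .{{_ : ℕ.NonZero D}} .{{_ : ℕ.NonZero d}} p q .(c : Coprime (suc p) (suc q)) →
             ∣ e * d - r * D ∣ * suc q < suc p * (D * d) →
             ℚ.∣ + e ℚ./ D ℚ.- + r ℚ./ d ∣ ℚ.< mkℚ (+ suc p) q c
∣e/D-r/d∣< e (suc D) r (suc d) p q c ∣ed-rD∣q<pDd = ℚP.toℚᵘ-cancel-< (ℚᵘP.<-respˡ-≃ (ℚᵘP.≃-sym toℚᵘ-∣x-y∣)
  (*<* (subst₂ ℤ._<_ (sym cross) (sym (ℤP.pos-* (suc p) (suc D * suc d))) (ℤ.+<+ ∣ed-rD∣q<pDd))))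
  where
  x y : ℚ
  x = + e ℚ./ suc D
  y = + r ℚ./ suc d
  toℚᵘ-∣x-y∣ : toℚᵘ (ℚ.∣ x ℚ.- y ∣) ℚᵘ.≃ ℚᵘ.∣ mkℚᵘ (+ e) D ℚᵘ.- mkℚᵘ (+ r) d ∣
  toℚᵘ-∣x-y∣ = ℚᵘP.≃-trans (ℚP.toℚᵘ-homo-∣-∣ (x ℚ.- y)) (ℚᵘP.∣-∣-cong
    (ℚᵘP.≃-trans (ℚP.toℚᵘ-homo-+ x (ℚ.- y))
      (ℚᵘP.+-cong (ℚP.toℚᵘ-fromℚᵘ (mkℚᵘ (+ e) D))
                  (ℚᵘP.≃-trans (ℚP.toℚᵘ-homo‿- y) (ℚᵘP.-‿cong (ℚP.toℚᵘ-fromℚᵘ (mkℚᵘ (+ r) d)))))))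
  numerator : + e ℤ.* + suc d ℤ.+ ℤ.- (+ r) ℤ.* + suc D ≡ (e * suc d) ℤ.⊖ (r * suc D)
  numerator = trans (cong₂ ℤ._+_ (sym (ℤP.pos-* e (suc d)))
                                 (trans (sym (ℤP.neg-distribˡ-* (+ r) (+ suc D))) (cong ℤ.-_ (sym (ℤP.pos-* r (suc D))))))
                    (ℤP.m-n≡m⊖n (e * suc d) (r * suc D))
  cross : + ℤ.∣ + e ℤ.* + suc d ℤ.+ ℤ.- (+ r) ℤ.* + suc D ∣ ℤ.* + suc q ≡ + (∣ e * suc d - r * suc D ∣ * suc q)
  cross = trans (cong (λ z → + ℤ.∣ z ∣ ℤ.* + suc q) numerator)
          (trans (cong (λ z → + z ℤ.* + suc q) (∣m⊖n∣≡∣m-n∣ (e * suc d) (r * suc D)))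
                 (sym (ℤP.pos-* ∣ e * suc d - r * suc D ∣ (suc q))))

probZeroSetSize-close : ∀ u i p q .(c : Coprime (suc p) (suc q)) → errorFactor i * suc q ≤ u →
  ℚ.∣ probZeroSetSize (2 + u + i) (2 + i) ℚ.- limitValue (2 + i) ∣ ℚ.< mkℚ (+ suc p) q c
probZeroSetSize-close u i p q c u-large =
  subst (λ x → ℚ.∣ x ℚ.- limitValue (2 + i) ∣ ℚ.< mkℚ (+ suc p) q c) (sym (uniformProb≡ _ (dyckPaths n) {{D≢0}}))
    (∣e/D-r/d∣< E D (suc i) (2 ^ (2 + i)) {{D≢0}} {{ℕP.m^n≢0 2 (2 + i)}} p q c
      (ℕP.<-≤-trans (m*o≤n*k⇒k*q<o⇒m*q<n {∣ E * 2 ^ (2 + i) - suc i * D ∣} (suc q) error errorFactor*q<M {{D≢0}})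
                    D≤p*D*2^k))
  where
  n D E : ℕ
  n = 2 + u + i
  D = length (dyckPaths n)
  E = length (filter (λ s → zeroSetSize n s ℕ.≟ 2 + i) (dyckPaths n))
  D≢0 : ℕ.NonZero D
  D≢0 = ℕ.>-nonZero (subst (0 <_) (sym (length-dyckPaths n)) (catalan-pos n))
  error : ∣ E * 2 ^ (2 + i) - suc i * D ∣ * (2 * (3 + u + i)) ≤ D * errorFactor i
  error = subst₂ (λ e d → ∣ e * 2 ^ (2 + i) - suc i * d ∣ * (2 * (3 + u + i)) ≤ d * errorFactor i)
                 (sym (count-returns u i)) (sym (length-dyckPaths n)) (ratio-estimate u i)
  errorFactor*q<M : errorFactor i * suc q < 2 * (3 + u + i)
  errorFactor*q<M = ℕP.≤-trans (s≤s u-large) (m+o≡n⇒m≤n (u + i + i + 5) (lemma u i))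
    where lemma : ∀ u i → suc u + (u + i + i + 5) ≡ 2 * (3 + u + i)
          lemma = solve-∀
  D≤p*D*2^k : D ≤ suc p * (D * 2 ^ (2 + i))
  D≤p*D*2^k = ℕP.≤-trans (ℕP.m≤m*n D (2 ^ (2 + i)) {{ℕP.m^n≢0 2 (2 + i)}}) (ℕP.m≤n*m (D * 2 ^ (2 + i)) (suc p))

corollary2 : ∀ (k : ℕ) → 2 ≤ k → ConvergesTo (λ n → probZeroSetSize n k) (limitValue k)
corollary2 (suc (suc i)) _ (mkℚ (+ suc p) q c) _ = 2 + errorFactor i * suc q + i , close
  where
  close : ∀ n → 2 + errorFactor i * suc q + i ≤ n →
          ℚ.∣ probZeroSetSize n (2 + i) ℚ.- limitValue (2 + i) ∣ ℚ.< mkℚ (+ suc p) q c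
  close n N₀≤n with ℕP.m≤n⇒∃[o]m+o≡n N₀≤n
  ... | o , refl = subst (λ m → ℚ.∣ probZeroSetSize m (2 + i) ℚ.- limitValue (2 + i) ∣ ℚ.< mkℚ (+ suc p) q c)
                         (lemma (errorFactor i * suc q) o i)
                         (probZeroSetSize-close (errorFactor i * suc q + o) i p q c (ℕP.m≤m+n _ o))
    where lemma : ∀ a o i → 2 + (a + o) + i ≡ 2 + a + i + o
          lemma = solve-∀
corollary2 (suc (suc i)) _ (mkℚ (+ zero) q c)  (ℚ.*<* (ℤ.+<+ ()))
corollary2 (suc (suc i)) _ (mkℚ -[1+ _ ] q c)  (ℚ.*<* ())
corollary2 1             (s≤s ())
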